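{- Let $C,D\subseteq[n]\times[n]$ be diagrams, $k,l\in[n]$, and $K\in\mathrm{Purple}_{k,l}(D)$. If $\widehat{C}_{k,l}\le\widehat{D}_{k,l}$, then $\widehat{C}_{k,l}\cup K\le D$ and $\widehat{C}_{k,l}\cap K=\varnothing$.
   Context: A diagram is a subset of $[n]\times[n]$ (box $(i,j)$ in row $i$, column $j$), with columns $D_j=\{i:(i,j)\in D\}$. For $R,S\subseteq[n]$, $R\le S$ means $\#R=\#S$ and the $t$-th smallest element of $R$ is at most the $t$-th smallest of $S$ for all $t$; $C\le D$ means $C_j\le D_j$ for all $j$. $\widehat{C}_{k,l}$ is $C$ with all boxes in row $k$ or column $l$ removed. $\mathrm{purple}_{k,l}(D)$ is the set of boxes $(i,j)$ such that some $C\le D$ contains $(i,j)$, but no $C\le D$ with $\widehat{C}_{k,l}\le\widehat{D}_{k,l}$ has $(i,j)\in\widehat{C}_{k,l}$. $\mathrm{Purple}_{k,l}(D)$ is the smallest set of diagrams containing $D\setminus\widehat{D}_{k,l}$ and such that if $K\in\mathrm{Purple}_{k,l}(D)$, $K'\le K$ and $K'\subseteq\mathrm{purple}_{k,l}(D)$ then $K'\in\mathrm{Purple}_{k,l}(D)$. -}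

module Defs where

open import Data.Nat using (ℕ)
open import Data.Bool using (Bool; true; false; _∧_; _∨_; not; T)
open import Data.Fin using (Fin; _≤_; _≟_)
open import Data.List using (List; filter)
open import Data.List.Relation.Binary.Pointwise using (Pointwise)
open import Data.Product using (Σ; ∃; _×_)
open import Relation.Binary.PropositionalEquality using (_≡_)
open import Relation.Nullary using (¬_; does)
open import Relation.Nullary.Decidable using (isYes)
open import Data.List using (allFin)
open import Data.Bool.Properties using (T?)

Subset : ℕ → Set
Subset n = Fin n → Bool

elems : ∀ {n} → Subset n → List (Fin n)
elems {n} R = filter (λ i → T? (R i)) (allFin n)

-- R ≤ S : #R = #S and the t-th smallest element of R is ≤ the t-th smallest of S
-- (Pointwise forces equal lengths).
_≤ₛ_ : ∀ {n} → Subset n → Subset n → Set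
R ≤ₛ S = Pointwise _≤_ (elems R) (elems S)

-- A diagram: box (i , j) = row i, column j.
Diagram : ℕ → Set
Diagram n = Fin n → Fin n → Bool

column : ∀ {n} → Diagram n → Fin n → Subset n
column D j i = D i j

_≤ᴰ_ : ∀ {n} → Diagram n → Diagram n → Set
C ≤ᴰ D = ∀ j → column C j ≤ₛ column D j

hat : ∀ {n} → Diagram n → Fin n → Fin n → Diagram n
hat C k l i j = C i j ∧ not (isYes (i ≟ k)) ∧ not (isYes (j ≟ l))

_∪ᴰ_ : ∀ {n} → Diagram n → Diagram n → Diagram n
(C ∪ᴰ D) i j = C i j ∨ D i j

diffHat : ∀ {n} → Diagram n → Fin n → Fin n → Diagram n
diffHat D k l i j = D i j ∧ not (hat D k l i j)

purple : ∀ {n} → Diagram n → Fin n → Fin n → Fin n → Fin n → Set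
purple {n} D k l i j =
  (Σ (Diagram n) λ C → C ≤ᴰ D × C i j ≡ true) ×
  ¬ (Σ (Diagram n) λ C → C ≤ᴰ D × hat C k l ≤ᴰ hat D k l × hat C k l i j ≡ true)

-- Purple_{k,l}(D): the smallest set of diagrams containing D \ D̂_{k,l} and closed under
-- K ↦ K' whenever K' ≤ K and K' ⊆ purple_{k,l}(D).
-- (Diagrams are compared extensionally, hence the pointwise-equality in 'base'.)
data Purple {n} (D : Diagram n) (k l : Fin n) : Diagram n → Set where
  base : ∀ {K} → (∀ i j → K i j ≡ diffHat D k l i j) → Purple D k l K
  step : ∀ {K K'} → Purple D k l K → K' ≤ᴰ K →
         (∀ i j → K' i j ≡ true → purple D k l i j) → Purple D k l K'

{-# OPTIONS --safe #-}
-- R ≤ S holds iff, reading positions upwards, R never has fewer elements than S in an initial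
-- segment and the sizes agree; adding a set disjoint from both keeps both counts in step, so
-- X ≤ Y gives A ∪ X ≤ A ∪ Y.  The boxes of D \ D̂ lie in row k or column l, so they avoid Ĉ and
-- D̂, whence (D \ D̂) ∪ Ĉ ≤ D; its hat is Ĉ ≤ D̂, so no box of Ĉ is purple and Ĉ avoids every
-- K ∈ Purple.  Along the generation of Purple, K′ ≤ K then gives Ĉ ∪ K′ ≤ Ĉ ∪ K ≤ D.

module Submission where

open import Defs
open import Data.Nat using (ℕ; zero; suc; _≤_; _+_)
open import Data.Nat.Properties using (≤-refl; ≤-trans; n≤1+n; +-comm; +-suc; +-identityʳ; <-irrefl)
open import Data.Bool using (Bool; true; false; _∧_; _∨_; not; T)
open import Data.Bool.Properties using (T?; ∨-comm; ∧-comm; ∧-zeroʳ)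
open import Data.Fin using (Fin; toℕ; _≟_)
import Data.Fin as Fin
import Data.Fin.Properties as Finₚ
open import Data.Vec.Functional using (head; tail)
open import Data.List using (List; []; _∷_; _++_; _∷ʳ_; [_]; map; filter; tabulate; length; allFin)
open import Data.List.Properties using (++-assoc; length-++; filter-≐)
open import Data.List.Relation.Unary.All as All using (All; []; _∷_)
open import Data.List.Relation.Unary.All.Properties using (∷ʳ⁺)
open import Data.List.Relation.Binary.Pointwise as Pointwise using (Pointwise; []; _∷_)
open import Data.List.Relation.Binary.Pointwise.Properties using (transitive)
open import Data.Product using (_×_; _,_)
open import Data.Empty using (⊥; ⊥-elim)
open import Function using (_∘_)
open import Relation.Binary.PropositionalEquality using (_≡_; _≗_; refl; sym; trans; cong; cong₂; subst; subst₂)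
open import Relation.Nullary using (¬_)
open import Relation.Nullary.Decidable using (isYes)

_∪ₛ_ : ∀ {n} → Subset n → Subset n → Subset n
(A ∪ₛ X) i = A i ∨ X i

Disjoint : ∀ {n} → Subset n → Subset n → Set
Disjoint A X = ∀ i → A i ∧ X i ≡ false

≤ₛ-trans : ∀ {n} {R S T : Subset n} → R ≤ₛ S → S ≤ₛ T → R ≤ₛ T
≤ₛ-trans = transitive Finₚ.≤-trans

elems-cong : ∀ {n} {R R′ : Subset n} → R ≗ R′ → elems R ≡ elems R′
elems-cong {n} {R} {R′} R≗R′ = filter-≐ (T? ∘ R) (T? ∘ R′) ((λ {i} → subst T (R≗R′ i)) , (λ {i} → subst T (sym (R≗R′ i)))) (allFin n)

≤ₛ-resp-≗ : ∀ {n} {R R′ S S′ : Subset n} → R ≗ R′ → S ≗ S′ → R ≤ₛ S → R′ ≤ₛ S′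
≤ₛ-resp-≗ R≗R′ S≗S′ = subst₂ (Pointwise Fin._≤_) (elems-cong R≗R′) (elems-cong S≗S′)

elemsFrom : ∀ {n} → Subset n → ℕ → List ℕ
elemsFrom {zero}  R o = []
elemsFrom {suc n} R o with R Fin.zero
... | true  = o ∷ elemsFrom (tail R) (suc o)
... | false = elemsFrom (tail R) (suc o)

map-toℕ-filter-tabulate : ∀ {m n} (Q : Subset m) (g : Fin n → Fin m) o → (∀ i → toℕ (g i) ≡ o + toℕ i) →
  map toℕ (filter (T? ∘ Q) (tabulate g)) ≡ elemsFrom (Q ∘ g) o
map-toℕ-filter-tabulate {n = zero}  Q g o g≡o+ = refl
map-toℕ-filter-tabulate {n = suc n} Q g o g≡o+
  with ih ← map-toℕ-filter-tabulate Q (g ∘ Fin.suc) (suc o) (λ i → trans (g≡o+ (Fin.suc i)) (+-suc o (toℕ i)))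
     | Q (g Fin.zero)
... | true  = cong₂ _∷_ (trans (g≡o+ Fin.zero) (+-identityʳ o)) ih
... | false = ih

map-toℕ-elems : ∀ {n} (R : Subset n) → map toℕ (elems R) ≡ elemsFrom R 0
map-toℕ-elems R = map-toℕ-filter-tabulate R (λ i → i) 0 (λ i → refl)

elemsFrom-≥ : ∀ {n} (R : Subset n) o → All (o ≤_) (elemsFrom R o)
elemsFrom-≥ {zero}  R o = []
elemsFrom-≥ {suc n} R o with R Fin.zero
... | true  = ≤-refl ∷ All.map (≤-trans (n≤1+n o)) (elemsFrom-≥ (tail R) (suc o))
... | false = All.map (≤-trans (n≤1+n o)) (elemsFrom-≥ (tail R) (suc o))

-- Reading one more position, which lies in R iff r and in S iff s, updates the surplus d.
Step : Bool → Bool → ℕ → (ℕ → Set) → Set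
Step true  true  d       next = next d
Step true  false d       next = next (suc d)
Step false true  zero    next = ⊥
Step false true  (suc d) next = next d
Step false false d       next = next d

Step-map : ∀ {r s d} {P Q : ℕ → Set} → (∀ {e} → P e → Q e) → Step r s d P → Step r s d Q
Step-map {true}  {true}            f p = f p
Step-map {true}  {false}           f p = f p
Step-map {false} {true}  {suc d}   f p = f p
Step-map {false} {false}           f p = f p

-- Dominates d R S: with d elements of R still unmatched, every prefix of R has at least as many
-- elements as that prefix of S, and the totals agree.
Dominates : ∀ {n} → ℕ → Subset n → Subset n → Set
Dominates {zero}  d R S = d ≡ 0
Dominates {suc n} d R S = Step (head R) (head S) d (λ e → Dominates e (tail R) (tail S))

length-∷ʳ : ∀ {A : Set} (xs : List A) x → length (xs ∷ʳ x) ≡ suc (length xs)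
length-∷ʳ xs x = trans (length-++ xs) (+-comm (length xs) 1)

Pointwise-∷ʳ-++ : ∀ {xs ys zs : List ℕ} x → Pointwise _≤_ (xs ∷ʳ x ++ ys) zs → Pointwise _≤_ (xs ++ x ∷ ys) zs
Pointwise-∷ʳ-++ {xs} {ys} x = subst (λ ws → Pointwise _≤_ ws _) (++-assoc xs [ x ] ys)

Pointwise-++-∷ʳ : ∀ {xs ys zs : List ℕ} x → Pointwise _≤_ (xs ++ x ∷ ys) zs → Pointwise _≤_ (xs ∷ʳ x ++ ys) zs
Pointwise-++-∷ʳ {xs} {ys} x = subst (λ ws → Pointwise _≤_ ws _) (sym (++-assoc xs [ x ] ys))

pending-suc : ∀ {o} {P : List ℕ} → All (_≤ o) P → All (_≤ suc o) P
pending-suc {o} = All.map (λ p≤o → ≤-trans p≤o (n≤1+n o))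

pending-∷ʳ : ∀ {o} {P : List ℕ} → All (_≤ o) P → All (_≤ suc o) (P ∷ʳ o)
pending-∷ʳ {o} P≤o = ∷ʳ⁺ (pending-suc P≤o) (n≤1+n o)

-- P lists the elements of R not yet matched with an element of S; all of them precede position o.
dominates⇒pointwise : ∀ {n} (R S : Subset n) o (P : List ℕ) {d} → length P ≡ d → All (_≤ o) P →
  Dominates d R S → Pointwise _≤_ (P ++ elemsFrom R o) (elemsFrom S o)
dominates⇒pointwise {zero}  R S o []      refl _ _ = []
dominates⇒pointwise {zero}  R S o (_ ∷ _) refl _ ()
dominates⇒pointwise {suc n} R S o P refl P≤o dom with R Fin.zero | S Fin.zero
dominates⇒pointwise {suc n} R S o []      refl [] dom | true | true =
  ≤-refl ∷ dominates⇒pointwise (tail R) (tail S) (suc o) [] refl [] dom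
dominates⇒pointwise {suc n} R S o (p ∷ P) refl (p≤o ∷ P≤o) dom | true | true =
  p≤o ∷ Pointwise-∷ʳ-++ o (dominates⇒pointwise (tail R) (tail S) (suc o) (P ∷ʳ o)
    (length-∷ʳ P o) (pending-∷ʳ P≤o) dom)
dominates⇒pointwise {suc n} R S o P refl P≤o dom | true | false =
  Pointwise-∷ʳ-++ o (dominates⇒pointwise (tail R) (tail S) (suc o) (P ∷ʳ o)
    (length-∷ʳ P o) (pending-∷ʳ P≤o) dom)
dominates⇒pointwise {suc n} R S o (p ∷ P) refl (p≤o ∷ P≤o) dom | false | true =
  p≤o ∷ dominates⇒pointwise (tail R) (tail S) (suc o) P refl (pending-suc P≤o) dom
dominates⇒pointwise {suc n} R S o P refl P≤o dom | false | false =
  dominates⇒pointwise (tail R) (tail S) (suc o) P refl (pending-suc P≤o) dom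

elemsFrom-⋠ : ∀ {n} (R : Subset n) o {ys} → ¬ Pointwise _≤_ (elemsFrom R (suc o)) (o ∷ ys)
elemsFrom-⋠ R o pw with elemsFrom R (suc o) | elemsFrom-≥ R (suc o)
elemsFrom-⋠ R o (x≤o ∷ _) | x ∷ _ | o<x ∷ _ = <-irrefl refl (≤-trans o<x x≤o)

pointwise⇒dominates : ∀ {n} (R S : Subset n) o (P : List ℕ) {d} → length P ≡ d →
  Pointwise _≤_ (P ++ elemsFrom R o) (elemsFrom S o) → Dominates d R S
pointwise⇒dominates {zero}  R S o []      refl [] = refl
pointwise⇒dominates {zero}  R S o (_ ∷ _) refl ()
pointwise⇒dominates {suc n} R S o P refl pw with R Fin.zero | S Fin.zero
pointwise⇒dominates {suc n} R S o []      refl (_ ∷ pw) | true | true =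
  pointwise⇒dominates (tail R) (tail S) (suc o) [] refl pw
pointwise⇒dominates {suc n} R S o (p ∷ P) refl (_ ∷ pw) | true | true =
  pointwise⇒dominates (tail R) (tail S) (suc o) (P ∷ʳ o) (length-∷ʳ P o) (Pointwise-++-∷ʳ o pw)
pointwise⇒dominates {suc n} R S o P refl pw | true | false =
  pointwise⇒dominates (tail R) (tail S) (suc o) (P ∷ʳ o) (length-∷ʳ P o) (Pointwise-++-∷ʳ o pw)
pointwise⇒dominates {suc n} R S o []      refl pw | false | true = elemsFrom-⋠ (tail R) o pw
pointwise⇒dominates {suc n} R S o (p ∷ P) refl (_ ∷ pw) | false | true =
  pointwise⇒dominates (tail R) (tail S) (suc o) P refl pw
pointwise⇒dominates {suc n} R S o P refl pw | false | false =
  pointwise⇒dominates (tail R) (tail S) (suc o) P refl pw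

≤ₛ⇒dominates : ∀ {n} {R S : Subset n} → R ≤ₛ S → Dominates 0 R S
≤ₛ⇒dominates {R = R} {S} R≤S = pointwise⇒dominates R S 0 [] refl
  (subst₂ (Pointwise _≤_) (map-toℕ-elems R) (map-toℕ-elems S) (Pointwise.map⁺ toℕ toℕ R≤S))

dominates⇒≤ₛ : ∀ {n} {R S : Subset n} → Dominates 0 R S → R ≤ₛ S
dominates⇒≤ₛ {R = R} {S} dom = Pointwise.map⁻ toℕ toℕ
  (subst₂ (Pointwise _≤_) (sym (map-toℕ-elems R)) (sym (map-toℕ-elems S)) (dominates⇒pointwise R S 0 [] refl [] dom))

-- A common element leaves the surplus unchanged.
Dominates-∪ : ∀ {n d} {A X Y : Subset n} → Disjoint A X → Disjoint A Y →
  Dominates d X Y → Dominates d (A ∪ₛ X) (A ∪ₛ Y)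
Dominates-∪ {zero} _ _ d≡0 = d≡0
Dominates-∪ {suc n} {A = A} {X} {Y} A∩X A∩Y dom with A Fin.zero | X Fin.zero | Y Fin.zero | A∩X Fin.zero | A∩Y Fin.zero
... | true  | false | false | _ | _ = Dominates-∪ (A∩X ∘ Fin.suc) (A∩Y ∘ Fin.suc) dom
... | false | x     | y     | _ | _ = Step-map {x} {y} (Dominates-∪ (A∩X ∘ Fin.suc) (A∩Y ∘ Fin.suc)) dom

∪-monoʳ-≤ₛ : ∀ {n} {A X Y : Subset n} → Disjoint A X → Disjoint A Y → X ≤ₛ Y → (A ∪ₛ X) ≤ₛ (A ∪ₛ Y)
∪-monoʳ-≤ₛ A∩X A∩Y X≤Y = dominates⇒≤ₛ (Dominates-∪ A∩X A∩Y (≤ₛ⇒dominates X≤Y))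

diffHat-∩-hat : ∀ {n} (C D : Diagram n) k l i j → diffHat D k l i j ∧ hat C k l i j ≡ false
diffHat-∩-hat C D k l i j with D i j | C i j | not (isYes (i ≟ k)) ∧ not (isYes (j ≟ l))
... | false | _     | _     = refl
... | true  | false | false = refl
... | true  | false | true  = refl
... | true  | true  | false = refl
... | true  | true  | true  = refl

diffHat-∪-hat : ∀ {n} (D : Diagram n) k l i j → diffHat D k l i j ∨ hat D k l i j ≡ D i j
diffHat-∪-hat D k l i j with D i j | not (isYes (i ≟ k)) ∧ not (isYes (j ≟ l))
... | false | _     = refl
... | true  | false = refl
... | true  | true  = refl

hat-diffHat-∪-hat : ∀ {n} (C D : Diagram n) k l i j →
  hat (diffHat D k l ∪ᴰ hat C k l) k l i j ≡ hat C k l i j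
hat-diffHat-∪-hat C D k l i j with D i j | C i j | not (isYes (i ≟ k)) ∧ not (isYes (j ≟ l))
... | false | false | true  = refl
... | false | true  | true  = refl
... | true  | false | true  = refl
... | true  | true  | true  = refl
... | _     | c     | false = trans (∧-zeroʳ _) (sym (∧-zeroʳ c))

module _ {n} (C D : Diagram n) (k l : Fin n) (Ĉ≤D̂ : hat C k l ≤ᴰ hat D k l) where

  diffHat-∪-hat-≤ᴰ : (diffHat D k l ∪ᴰ hat C k l) ≤ᴰ D
  diffHat-∪-hat-≤ᴰ j = ≤ₛ-resp-≗ (λ _ → refl) (λ i → diffHat-∪-hat D k l i j)
    (∪-monoʳ-≤ₛ (λ i → diffHat-∩-hat C D k l i j) (λ i → diffHat-∩-hat D D k l i j) (Ĉ≤D̂ j))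

  hat-diffHat-∪-hat-≤ᴰ : hat (diffHat D k l ∪ᴰ hat C k l) k l ≤ᴰ hat D k l
  hat-diffHat-∪-hat-≤ᴰ j = ≤ₛ-resp-≗ (λ i → sym (hat-diffHat-∪-hat C D k l i j)) (λ _ → refl) (Ĉ≤D̂ j)

  hat-∉-purple : ∀ {i j} → hat C k l i j ≡ true → ¬ purple D k l i j
  hat-∉-purple {i} {j} Ĉᵢⱼ (_ , unreachable) = unreachable
    ( diffHat D k l ∪ᴰ hat C k l , diffHat-∪-hat-≤ᴰ , hat-diffHat-∪-hat-≤ᴰ
    , trans (hat-diffHat-∪-hat C D k l i j) Ĉᵢⱼ )

  hat-∩-Purple : ∀ {K} → Purple D k l K → ∀ i j → hat C k l i j ∧ K i j ≡ false
  hat-∩-Purple (base K≗B) i j rewrite K≗B i j = trans (∧-comm (hat C k l i j) _) (diffHat-∩-hat C D k l i j)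
  hat-∩-Purple (step {K' = K′} _ _ K′⊆purple) i j with hat C k l i j in Ĉᵢⱼ | K′ i j in K′ᵢⱼ
  ... | false | _     = refl
  ... | true  | false = refl
  ... | true  | true  = ⊥-elim (hat-∉-purple Ĉᵢⱼ (K′⊆purple i j K′ᵢⱼ))

  hat-∪-Purple-≤ᴰ : ∀ {K} → Purple D k l K → (hat C k l ∪ᴰ K) ≤ᴰ D
  hat-∪-Purple-≤ᴰ (base K≗B) j = ≤ₛ-resp-≗ (λ i → trans (∨-comm (diffHat D k l i j) _) (cong (_ ∨_) (sym (K≗B i j))))
    (λ _ → refl) (diffHat-∪-hat-≤ᴰ j)
  hat-∪-Purple-≤ᴰ K′∈@(step K∈ K′≤K _) j =
    ≤ₛ-trans (∪-monoʳ-≤ₛ (λ i → hat-∩-Purple K′∈ i j) (λ i → hat-∩-Purple K∈ i j) (K′≤K j))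
             (hat-∪-Purple-≤ᴰ K∈ j)

lemma4p6 : ∀ (n : ℕ) (C D : Diagram n) (k l : Fin n) (K : Diagram n) →
    Purple D k l K →
    hat C k l ≤ᴰ hat D k l →
    ((hat C k l ∪ᴰ K) ≤ᴰ D) × (∀ i j → (hat C k l i j ∧ K i j) ≡ false)
lemma4p6 n C D k l K K∈ Ĉ≤D̂ = hat-∪-Purple-≤ᴰ C D k l Ĉ≤D̂ K∈ , hat-∩-Purple C D k l Ĉ≤D̂ K∈
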